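{- Let $G=C_n^3$ with $n\ge 2$. Then $\rho_3(G)\ge\mathsf D^*(G)+\lfloor \mathsf D^*(G)/2\rfloor$ with a spread $X\in\mathcal F(\{2,3\})$. Moreover, $\mathsf v_3(X)=1$ if $\mathsf D^*(G)$ is odd, and $\mathrm{supp}(X)=\{2\}$ if $\mathsf D^*(G)$ is even.
   Context: $C_n^3$ is the direct sum of three cyclic groups of order $n$, and $\mathsf D^*(C_n^3)=3n-2$ (in general $\mathsf D^*(G)=1+\sum_i(n_i-1)$ for $G\cong C_{n_1}\oplus\ldots\oplus C_{n_r}$, $1<n_1\mid\ldots\mid n_r$). For a finite abelian group $G$, sequences over $G$ are elements of the free abelian monoid $\mathcal F(G)$, $\mathcal B(G)$ is the monoid of zero-sum sequences, and its atoms $\mathcal A(G)$ are the minimal zero-sum sequences. For $\omega\in\mathbb N$ and $X\in\mathcal F(\mathbb Z)$ (a finite multiset of integers), "$\rho_3(G)\ge\omega$ with spread $X$" means: there exist atoms $U_1,U_2,U_3,W_1,\dots,W_\rho\in\mathcal A(G)$ with $U_1U_2U_3=W_1\cdots W_\rho$ and $\rho\ge\omega$, together with subsequences $T_{i,j}\mid U_j$ ($i\in[1,\rho]$, $j\in[1,3]$) such that $W_i=T_{i,1}T_{i,2}T_{i,3}$ for all $i$ and $\prod_{i=1}^\rho T_{i,j}=U_j$ for all $j$, and $X=\prod_{i=1}^\rho x_i$ where $x_i$ is the number of $j$ with $T_{i,j}$ nonempty. $X\in\mathcal F(\{2,3\})$ means every entry is $2$ or $3$, $\mathsf v_3(X)$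 is the number of entries equal to $3$, $\mathrm{supp}(X)$ the set of distinct entries. -}

module Defs where

open import Data.Nat using (ℕ; _+_; _*_; _∸_; _/_; _≤_)
open import Data.Nat.Divisibility using (_∣_)
open import Data.Fin using (Fin; toℕ; zero; suc)
open import Data.Vec using (Vec; lookup)
open import Data.List using (List; []; _++_; map; length; concat; filter; null; allFin)
open import Data.List.Relation.Binary.Sublist.Propositional using (_⊆_)
open import Data.List.Relation.Binary.Permutation.Propositional using (_↭_)
open import Data.Nat.ListAction using (sum)
open import Data.Bool using (if_then_else_)
open import Data.Product using (Σ; _×_)
open import Relation.Binary.PropositionalEquality using (_≡_; _≢_)

Grp : ℕ → Set
Grp n = Vec (Fin n) 3

-- Sequences over G (elements of F(G)) are finite lists, considered up to
-- permutation (_↭_); sub-sequences are sublists (_⊆_).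
Seq : ℕ → Set
Seq n = List (Grp n)

ZeroSum : (n : ℕ) → Seq n → Set
ZeroSum n S = (k : Fin 3) → n ∣ sum (map (λ g → toℕ (lookup g k)) S)

IsAtom : (n : ℕ) → Seq n → Set
IsAtom n S =
  S ≢ [] × ZeroSum n S ×
  ((S' : Seq n) → S' ⊆ S → S' ≢ [] → ZeroSum n S' → length S' ≡ length S)

Dstar3 : ℕ → ℕ
Dstar3 n = 3 * n ∸ 2

prodSeq : ∀ {A : Set} (ρ : ℕ) → (Fin ρ → List A) → List A
prodSeq ρ f = concat (map f (allFin ρ))

nonemptyCount : ∀ {A : Set} → (Fin 3 → List A) → ℕ
nonemptyCount T = sum (map (λ j → if null (T j) then 0 else 1) (allFin 3))

-- Data witnessing "ρ_3(G) ≥ ω with spread X", X = ∏ x_i where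
-- x_i = nonemptyCount (T i), with the additional requirements of the lemma
-- on X expressed in Statement.
record Factorization3 (n : ℕ) : Set where
  field
    ρ : ℕ
    U : Fin 3 → Seq n
    T : Fin ρ → Fin 3 → Seq n
    U-atom : (j : Fin 3) → IsAtom n (U j)
    W-atom : (i : Fin ρ) → IsAtom n (T i zero ++ T i (suc zero) ++ T i (suc (suc zero)))
    cols : (j : Fin 3) → prodSeq ρ (λ i → T i j) ↭ U j

  spread : Fin ρ → ℕ
  spread i = nonemptyCount (T i)

{-# OPTIONS --safe #-}
-- Each U_j is a "sandwich" X f₁^{n-1} f₂^{n-1} Y where f₁, f₂ are unit
-- multiples of basis vectors along axes k₁, k₂, and the n elements of X Y all have
-- coordinate 1 along the remaining axis k₃. Along k₃ a zero-sum subsequence therefore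
-- contains none or all of X Y, and in both cases the k₁- and k₂-coordinates force the
-- exponents of f₁ and f₂, so U_j is an atom. The W_i are pairs g (-g) split between two of
-- the U_j (plus one zero-sum triple when n is odd), and there are D*(G) + ⌊D*(G)/2⌋ of them.
module Submission where

open import Defs
open import Data.Nat using (ℕ; zero; suc; _+_; _*_; _∸_; _≤_; _<_; s≤s; z≤n; _/_; _%_; _≟_)
open import Data.Nat.Properties
open import Data.Nat.DivMod using (m*n/n≡m; m<n⇒m/n≡0; m<n⇒m%n≡m; [m+kn]%n≡m%n; +-distrib-/-∣ʳ)
open import Data.Nat.Divisibility using (_∣_; divides; _∣0; ∣m+n∣m⇒∣n; >⇒∤)
open import Data.Nat.Coprimality as Coprimality using (Coprime; coprime-divisor; coprime-+; 1-coprimeTo)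
open import Data.Nat.ListAction using (sum)
open import Data.Nat.ListAction.Properties using (sum-++)
open import Data.Fin using (Fin; toℕ; zero; suc; fromℕ)
open import Data.Fin.Properties using (toℕ-fromℕ)
open import Data.Maybe using (Maybe; just; nothing)
open import Function using (_∘_; id)
open import Data.Vec as Vec using (Vec; _∷_; [])
open import Data.List as List using (List; []; _∷_; _++_; replicate; map; length; concat; concatMap; fromMaybe; tabulate; filter; allFin)
open import Data.List.Properties using (filter-none; map-tabulate; tabulate-lookup; concatMap-++; map-++; length-++; length-replicate; ++-conicalˡ; ++-conicalʳ)
open import Data.List.Relation.Binary.Sublist.Propositional using (_⊆_; []; _∷_; _∷ʳ_)
open import Data.List.Relation.Binary.Sublist.Propositional.Properties using (length-mono-≤; to-≋; All-resp-⊆)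
open import Data.List.Relation.Binary.Pointwise using (Pointwise-≡⇒≡)
open import Data.List.Relation.Unary.All as All using (All; []; _∷_)
open import Data.List.Relation.Unary.All.Properties using (++⁺; replicate⁺; tabulate⁺)
open import Data.List.Membership.Propositional.Properties using (∈-lookup)
open import Data.List.Relation.Binary.Permutation.Propositional using (↭-reflexive)
open import Data.Product using (Σ; _×_; _,_; ∃₂; ∃-syntax; uncurry; proj₁; proj₂)
open import Data.Sum using (_⊎_; inj₁; inj₂)
open import Data.Empty using (⊥-elim)
open import Relation.Nullary using (¬_; contradiction)
open import Relation.Binary.PropositionalEquality
open import Data.Nat.Tactic.RingSolver using (solve-∀; solve)

private
  variable
    A : Set
    n : ℕ

⊆-++⁻ : (xs : List A) {ys zs : List A} → zs ⊆ xs ++ ys →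
        ∃₂ λ xs′ ys′ → zs ≡ xs′ ++ ys′ × xs′ ⊆ xs × ys′ ⊆ ys
⊆-++⁻ [] zs⊆ys = [] , _ , refl , [] , zs⊆ys
⊆-++⁻ (x ∷ xs) (.x ∷ʳ p) with xs′ , ys′ , refl , p₁ , p₂ ← ⊆-++⁻ xs p =
  xs′ , ys′ , refl , x ∷ʳ p₁ , p₂
⊆-++⁻ (x ∷ xs) (refl ∷ p) with xs′ , ys′ , refl , p₁ , p₂ ← ⊆-++⁻ xs p =
  x ∷ xs′ , ys′ , refl , refl ∷ p₁ , p₂

⊆-replicate⁻ : ∀ r {x : A} {xs} → xs ⊆ replicate r x → ∃[ p ] p ≤ r × xs ≡ replicate p x
⊆-replicate⁻ zero [] = 0 , z≤n , refl
⊆-replicate⁻ (suc r) (_ ∷ʳ xs⊆) with p , p≤r , refl ← ⊆-replicate⁻ r xs⊆ = p , m≤n⇒m≤1+n p≤r , refl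
⊆-replicate⁻ (suc r) (refl ∷ xs⊆) with p , p≤r , refl ← ⊆-replicate⁻ r xs⊆ = suc p , s≤s p≤r , refl

⊆-length-≡ : {xs ys : List A} → xs ⊆ ys → length xs ≡ length ys → xs ≡ ys
⊆-length-≡ xs⊆ys eq = Pointwise-≡⇒≡ (to-≋ eq xs⊆ys)

length≡0⇒[] : {xs : List A} → length xs ≡ 0 → xs ≡ []
length≡0⇒[] {xs = []} _ = refl

<∧∣⇒≡0 : ∀ {t} → t < n → n ∣ t → t ≡ 0
<∧∣⇒≡0 {t = zero} _ _ = refl
<∧∣⇒≡0 {t = suc t} t<n n∣t = ⊥-elim (>⇒∤ t<n n∣t)

≤∧∣⇒≡0⊎≡ : ∀ {t} → t ≤ n → n ∣ t → t ≡ 0 ⊎ t ≡ n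
≤∧∣⇒≡0⊎≡ t≤n n∣t with m≤n⇒m<n∨m≡n t≤n
... | inj₁ t<n = inj₁ (<∧∣⇒≡0 t<n n∣t)
... | inj₂ t≡n = inj₂ t≡n

+-≤-≡⇒≡ : ∀ {a b c d} → a ≤ c → b ≤ d → a + b ≡ c + d → a ≡ c × b ≡ d
+-≤-≡⇒≡ {a} {b} {c} {d} a≤c b≤d eq = a≡c , +-cancelˡ-≡ c b d (trans (cong (_+ b) (sym a≡c)) eq)
  where
  a≡c : a ≡ c
  a≡c = ≤-antisym a≤c (+-cancelʳ-≤ b c a (≤-trans (+-monoʳ-≤ c b≤d) (≤-reflexive (sym eq))))

private
  ≤-unit-cancel : ∀ {a p q u} → p ≤ q → q < n → Coprime n u →
                  n ∣ a + p * u → n ∣ a + q * u → p ≡ q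
  ≤-unit-cancel {n} {a} {p} {q} {u} p≤q q<n n⊥u n∣p n∣q = begin
    p             ≡⟨ +-identityʳ p ⟨
    p + 0         ≡⟨ cong (p +_) q∸p≡0 ⟨
    p + (q ∸ p)   ≡⟨ m+[n∸m]≡n p≤q ⟩
    q             ∎
    where
    open ≡-Reasoning
    split : ∀ a p d u → a + (p + d) * u ≡ (a + p * u) + u * d
    split = solve-∀
    n∣q′ : n ∣ (a + p * u) + u * (q ∸ p)
    n∣q′ = subst (n ∣_) (trans (cong (λ x → a + x * u) (sym (m+[n∸m]≡n p≤q))) (split a p (q ∸ p) u)) n∣q
    q∸p≡0 : q ∸ p ≡ 0
    q∸p≡0 = <∧∣⇒≡0 (≤-<-trans (m∸n≤m q p) q<n) (coprime-divisor n⊥u (∣m+n∣m⇒∣n n∣q′ n∣p))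

∣-unit-cancel : ∀ {a p q u} → p < n → q < n → Coprime n u →
                n ∣ a + p * u → n ∣ a + q * u → p ≡ q
∣-unit-cancel {p = p} {q} p<n q<n n⊥u n∣p n∣q with ≤-total p q
... | inj₁ p≤q = ≤-unit-cancel p≤q q<n n⊥u n∣p n∣q
... | inj₂ q≤p = sym (≤-unit-cancel q≤p p<n n⊥u n∣q n∣p)

coord : Fin 3 → Grp n → ℕ
coord k g = toℕ (Vec.lookup g k)

coordSum : Fin 3 → Seq n → ℕ
coordSum k S = sum (map (coord k) S)

coordSum-++ : ∀ k (S S′ : Seq n) → coordSum k (S ++ S′) ≡ coordSum k S + coordSum k S′
coordSum-++ k S S′ = trans (cong sum (map-++ (coord k) S S′)) (sum-++ (map (coord k) S) _)

coordSum-replicate : ∀ k r (g : Grp n) → coordSum k (replicate r g) ≡ r * coord k g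
coordSum-replicate k zero g = refl
coordSum-replicate k (suc r) g = cong (coord k g +_) (coordSum-replicate k r g)

coordSum-ones : ∀ k {S : Seq n} → All (λ g → coord k g ≡ 1) S → coordSum k S ≡ length S
coordSum-ones k [] = refl
coordSum-ones k (g≡1 ∷ S-ones) = cong₂ _+_ g≡1 (coordSum-ones k S-ones)

sandwich : Seq n → ℕ → Grp n → ℕ → Grp n → Seq n → Seq n
sandwich X p₁ f₁ p₂ f₂ Y = X ++ replicate p₁ f₁ ++ replicate p₂ f₂ ++ Y

coordSum-sandwich : ∀ k (X : Seq n) p₁ f₁ p₂ f₂ Y →
  coordSum k (sandwich X p₁ f₁ p₂ f₂ Y) ≡
  (coordSum k X + coordSum k Y + p₁ * coord k f₁) + p₂ * coord k f₂
coordSum-sandwich k X p₁ f₁ p₂ f₂ Y = begin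
  coordSum k (X ++ replicate p₁ f₁ ++ replicate p₂ f₂ ++ Y)
    ≡⟨ coordSum-++ k X _ ⟩
  x + coordSum k (replicate p₁ f₁ ++ replicate p₂ f₂ ++ Y)
    ≡⟨ cong (x +_) (coordSum-++ k (replicate p₁ f₁) _) ⟩
  x + (coordSum k (replicate p₁ f₁) + coordSum k (replicate p₂ f₂ ++ Y))
    ≡⟨ cong (λ z → x + (coordSum k (replicate p₁ f₁) + z)) (coordSum-++ k (replicate p₂ f₂) Y) ⟩
  x + (coordSum k (replicate p₁ f₁) + (coordSum k (replicate p₂ f₂) + y))
    ≡⟨ cong₂ (λ a b → x + (a + (b + y))) (coordSum-replicate k p₁ f₁) (coordSum-replicate k p₂ f₂) ⟩
  x + (p₁ * coord k f₁ + (p₂ * coord k f₂ + y))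
    ≡⟨ reorder x (p₁ * coord k f₁) (p₂ * coord k f₂) y ⟩
  (x + y + p₁ * coord k f₁) + p₂ * coord k f₂ ∎
  where
  open ≡-Reasoning
  x y : ℕ
  x = coordSum k X
  y = coordSum k Y
  reorder : ∀ x a b y → x + (a + (b + y)) ≡ (x + y + a) + b
  reorder = solve-∀

coordSum-sandwich-ones : ∀ k (X : Seq n) p₁ f₁ p₂ f₂ Y → coord k f₁ ≡ 0 → coord k f₂ ≡ 0 →
  All (λ g → coord k g ≡ 1) X → All (λ g → coord k g ≡ 1) Y →
  coordSum k (sandwich X p₁ f₁ p₂ f₂ Y) ≡ length X + length Y
coordSum-sandwich-ones k X p₁ f₁ p₂ f₂ Y f₁[k]≡0 f₂[k]≡0 X-ones Y-ones = begin
  coordSum k (sandwich X p₁ f₁ p₂ f₂ Y)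
    ≡⟨ coordSum-sandwich k X p₁ f₁ p₂ f₂ Y ⟩
  (coordSum k X + coordSum k Y + p₁ * coord k f₁) + p₂ * coord k f₂
    ≡⟨ cong (λ x → (x + p₁ * coord k f₁) + p₂ * coord k f₂)
            (cong₂ _+_ (coordSum-ones k X-ones) (coordSum-ones k Y-ones)) ⟩
  (length X + length Y + p₁ * coord k f₁) + p₂ * coord k f₂
    ≡⟨ cong₂ (λ x y → (length X + length Y + p₁ * x) + p₂ * y) f₁[k]≡0 f₂[k]≡0 ⟩
  (length X + length Y + p₁ * 0) + p₂ * 0
    ≡⟨ cong₂ (λ x y → (length X + length Y + x) + y) (*-zeroʳ p₁) (*-zeroʳ p₂) ⟩
  (length X + length Y + 0) + 0
    ≡⟨ trans (+-identityʳ _) (+-identityʳ _) ⟩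
  length X + length Y ∎
  where open ≡-Reasoning

⊆-sandwich⁻ : ∀ (X : Seq n) r₁ f₁ r₂ f₂ {Y S′} → S′ ⊆ sandwich X r₁ f₁ r₂ f₂ Y →
  ∃[ X′ ] ∃[ p₁ ] ∃[ p₂ ] ∃[ Y′ ]
    S′ ≡ sandwich X′ p₁ f₁ p₂ f₂ Y′ × X′ ⊆ X × p₁ ≤ r₁ × p₂ ≤ r₂ × Y′ ⊆ Y
⊆-sandwich⁻ X r₁ f₁ r₂ f₂ S′⊆
  with X′ , R₁ , refl , X′⊆X , R₁⊆ ← ⊆-++⁻ X S′⊆
  with F₁ , R₂ , refl , F₁⊆ , R₂⊆ ← ⊆-++⁻ (replicate r₁ f₁) R₁⊆
  with F₂ , Y′ , refl , F₂⊆ , Y′⊆Y ← ⊆-++⁻ (replicate r₂ f₂) R₂⊆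
  with p₁ , p₁≤r₁ , refl ← ⊆-replicate⁻ r₁ F₁⊆
  with p₂ , p₂≤r₂ , refl ← ⊆-replicate⁻ r₂ F₂⊆
  = X′ , p₁ , p₂ , Y′ , refl , X′⊆X , p₁≤r₁ , p₂≤r₂ , Y′⊆Y

module _ (k₁ k₂ : Fin 3) (f₁ f₂ : Grp n)
         (n⊥f₁ : Coprime n (coord k₁ f₁)) (n⊥f₂ : Coprime n (coord k₂ f₂))
         (f₂[k₁]≡0 : coord k₁ f₂ ≡ 0) where

  sandwich-exponents-unique : ∀ X Y {p₁ p₂ q₁ q₂} →
    p₁ < n → p₂ < n → q₁ < n → q₂ < n →
    ZeroSum n (sandwich X p₁ f₁ p₂ f₂ Y) → ZeroSum n (sandwich X q₁ f₁ q₂ f₂ Y) →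
    p₁ ≡ q₁ × p₂ ≡ q₂
  sandwich-exponents-unique X Y {p₁} {p₂} {q₁} {q₂} p₁<n p₂<n q₁<n q₂<n zp zq =
    p₁≡q₁ , p₂≡q₂
    where
    a : Fin 3 → ℕ
    a k = coordSum k X + coordSum k Y
    at : ∀ k p₁ p₂ → ZeroSum n (sandwich X p₁ f₁ p₂ f₂ Y) →
         n ∣ (a k + p₁ * coord k f₁) + p₂ * coord k f₂
    at k p₁ p₂ z = subst (n ∣_) (coordSum-sandwich k X p₁ f₁ p₂ f₂ Y) (z k)
    drop-f₂ : ∀ b p → b + p * coord k₁ f₂ ≡ b
    drop-f₂ b p = trans (cong (λ c → b + p * c) f₂[k₁]≡0)
                        (trans (cong (b +_) (*-zeroʳ p)) (+-identityʳ b))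
    p₁≡q₁ : p₁ ≡ q₁
    p₁≡q₁ = ∣-unit-cancel p₁<n q₁<n n⊥f₁ (subst (n ∣_) (drop-f₂ _ p₂) (at k₁ p₁ p₂ zp))
                                         (subst (n ∣_) (drop-f₂ _ q₂) (at k₁ q₁ q₂ zq))
    p₂≡q₂ : p₂ ≡ q₂
    p₂≡q₂ = ∣-unit-cancel p₂<n q₂<n n⊥f₂ (at k₂ p₁ p₂ zp)
              (subst (λ p → n ∣ (a k₂ + p * coord k₂ f₁) + q₂ * coord k₂ f₂) (sym p₁≡q₁) (at k₂ q₁ q₂ zq))

  sandwich-atom : ∀ k₃ X r₁ r₂ Y → coord k₃ f₁ ≡ 0 → coord k₃ f₂ ≡ 0 →
    All (λ g → coord k₃ g ≡ 1) X → All (λ g → coord k₃ g ≡ 1) Y →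
    length X + length Y ≡ n → r₁ < n → r₂ < n →
    ZeroSum n (sandwich X r₁ f₁ r₂ f₂ Y) → IsAtom n (sandwich X r₁ f₁ r₂ f₂ Y)
  sandwich-atom k₃ X r₁ r₂ Y f₁[k₃]≡0 f₂[k₃]≡0 X-ones Y-ones |X|+|Y|≡n r₁<n r₂<n zs =
    nonempty , zs , minimal
    where
    nonempty : sandwich X r₁ f₁ r₂ f₂ Y ≢ []
    nonempty S≡[] with refl ← ++-conicalˡ X _ S≡[]
                  with refl ← ++-conicalʳ (replicate r₂ f₂) Y
                    (++-conicalʳ (replicate r₁ f₁) _ (++-conicalʳ X _ S≡[]))
      = n≮0 (subst (r₁ <_) (sym |X|+|Y|≡n) r₁<n)

    minimal : (S′ : Seq n) → S′ ⊆ sandwich X r₁ f₁ r₂ f₂ Y → S′ ≢ [] → ZeroSum n S′ →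
              length S′ ≡ length (sandwich X r₁ f₁ r₂ f₂ Y)
    minimal S′ S′⊆S S′≢[] zs′
      with X′ , p₁ , p₂ , Y′ , refl , X′⊆X , p₁≤r₁ , p₂≤r₂ , Y′⊆Y ← ⊆-sandwich⁻ X r₁ f₁ r₂ f₂ S′⊆S
      with ≤∧∣⇒≡0⊎≡ (subst (length X′ + length Y′ ≤_) |X|+|Y|≡n
                      (+-mono-≤ (length-mono-≤ X′⊆X) (length-mono-≤ Y′⊆Y)))
                    (subst (n ∣_) (coordSum-sandwich-ones k₃ X′ p₁ f₁ p₂ f₂ Y′ f₁[k₃]≡0 f₂[k₃]≡0
                                     (All-resp-⊆ X′⊆X X-ones) (All-resp-⊆ Y′⊆Y Y-ones)) (zs′ k₃))
    ... | inj₁ none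
      with refl ← length≡0⇒[] {xs = X′} (m+n≡0⇒m≡0 _ none)
      with refl ← length≡0⇒[] {xs = Y′} (m+n≡0⇒n≡0 0 none)
      with refl , refl ← sandwich-exponents-unique [] [] (≤-<-trans p₁≤r₁ r₁<n) (≤-<-trans p₂≤r₂ r₂<n)
                           (≤-<-trans z≤n r₁<n) (≤-<-trans z≤n r₁<n) zs′ (λ _ → n ∣0)
      = ⊥-elim (S′≢[] refl)
    ... | inj₂ all
      with X′≡X , Y′≡Y ← +-≤-≡⇒≡ (length-mono-≤ X′⊆X) (length-mono-≤ Y′⊆Y) (trans all (sym |X|+|Y|≡n))
      with refl ← ⊆-length-≡ X′⊆X X′≡X
      with refl ← ⊆-length-≡ Y′⊆Y Y′≡Y
      with refl , refl ← sandwich-exponents-unique X Y (≤-<-trans p₁≤r₁ r₁<n) (≤-<-trans p₂≤r₂ r₂<n)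
                           r₁<n r₂<n zs′ zs
      = refl

pair-atom : (a b : Grp n) → ZeroSum n (a ∷ b ∷ []) →
            ¬ ZeroSum n (a ∷ []) → ¬ ZeroSum n (b ∷ []) → IsAtom n (a ∷ b ∷ [])
pair-atom {n} a b zs ¬a ¬b = (λ ()) , zs , minimal
  where
  minimal : (S′ : Seq n) → S′ ⊆ a ∷ b ∷ [] → S′ ≢ [] → ZeroSum n S′ → length S′ ≡ 2
  minimal _ (_ ∷ʳ (_ ∷ʳ []))   S′≢[] _ = ⊥-elim (S′≢[] refl)
  minimal _ (_ ∷ʳ (refl ∷ []))  _ z = ⊥-elim (¬b z)
  minimal _ (refl ∷ (_ ∷ʳ []))  _ z = ⊥-elim (¬a z)
  minimal _ (refl ∷ (refl ∷ [])) _ _ = refl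

triple-atom : (a b c : Grp n) → ZeroSum n (a ∷ b ∷ c ∷ []) →
  ¬ ZeroSum n (a ∷ []) → ¬ ZeroSum n (b ∷ []) → ¬ ZeroSum n (c ∷ []) →
  ¬ ZeroSum n (a ∷ b ∷ []) → ¬ ZeroSum n (a ∷ c ∷ []) → ¬ ZeroSum n (b ∷ c ∷ []) →
  IsAtom n (a ∷ b ∷ c ∷ [])
triple-atom {n} a b c zs ¬a ¬b ¬c ¬ab ¬ac ¬bc = (λ ()) , zs , minimal
  where
  minimal : (S′ : Seq n) → S′ ⊆ a ∷ b ∷ c ∷ [] → S′ ≢ [] → ZeroSum n S′ → length S′ ≡ 3
  minimal _ (_ ∷ʳ (_ ∷ʳ (_ ∷ʳ [])))    S′≢[] _ = ⊥-elim (S′≢[] refl)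
  minimal _ (_ ∷ʳ (_ ∷ʳ (refl ∷ [])))   _ z = ⊥-elim (¬c z)
  minimal _ (_ ∷ʳ (refl ∷ (_ ∷ʳ [])))   _ z = ⊥-elim (¬b z)
  minimal _ (_ ∷ʳ (refl ∷ (refl ∷ [])))  _ z = ⊥-elim (¬bc z)
  minimal _ (refl ∷ (_ ∷ʳ (_ ∷ʳ [])))   _ z = ⊥-elim (¬a z)
  minimal _ (refl ∷ (_ ∷ʳ (refl ∷ [])))  _ z = ⊥-elim (¬ac z)
  minimal _ (refl ∷ (refl ∷ (_ ∷ʳ [])))  _ z = ⊥-elim (¬ab z)
  minimal _ (refl ∷ (refl ∷ (refl ∷ []))) _ _ = refl

-- A row W_i = T_{i,1} T_{i,2} T_{i,3} in which every T_{i,j} has at most one element; a block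
-- is a row repeated a given number of times, and column j of a list of blocks is U_j.
Row : ℕ → Set
Row n = Vec (Maybe (Grp n)) 3

cells : Row n → Fin 3 → Seq n
cells w j = fromMaybe (Vec.lookup w j)

rowProduct : Row n → Seq n
rowProduct w = cells w zero ++ cells w (suc zero) ++ cells w (suc (suc zero))

rowSpread : Row n → ℕ
rowSpread w = nonemptyCount (cells w)

Block : ℕ → Set
Block n = ℕ × Row n

rows : List (Block n) → List (Row n)
rows = concatMap (uncurry replicate)

copies : ℕ → Maybe A → List A
copies r (just x) = replicate r x
copies r nothing  = []

column : Fin 3 → List (Block n) → Seq n
column j = concatMap (λ (r , w) → copies r (Vec.lookup w j))

concatMap-cells-replicate : ∀ j r (w : Row n) →
  concatMap (λ w → cells w j) (replicate r w) ≡ copies r (Vec.lookup w j)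
concatMap-cells-replicate j zero w with Vec.lookup w j
... | just x  = refl
... | nothing = refl
concatMap-cells-replicate j (suc r) w with Vec.lookup w j | concatMap-cells-replicate j r w
... | just x  | ih = cong (x ∷_) ih
... | nothing | ih = ih

concatMap-cells-rows : ∀ j (bs : List (Block n)) → concatMap (λ w → cells w j) (rows bs) ≡ column j bs
concatMap-cells-rows j [] = refl
concatMap-cells-rows j ((r , w) ∷ bs) = begin
  concatMap (λ w → cells w j) (replicate r w ++ rows bs)
    ≡⟨ concatMap-++ (λ w → cells w j) (replicate r w) (rows bs) ⟩
  concatMap (λ w → cells w j) (replicate r w) ++ concatMap (λ w → cells w j) (rows bs)
    ≡⟨ cong₂ _++_ (concatMap-cells-replicate j r w) (concatMap-cells-rows j bs) ⟩
  copies r (Vec.lookup w j) ++ column j bs ∎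
  where open ≡-Reasoning

prodSeq-lookup : ∀ {B : Set} (f : A → List B) xs → prodSeq (length xs) (f ∘ List.lookup xs) ≡ concatMap f xs
prodSeq-lookup f xs = cong concat (begin
  map (f ∘ List.lookup xs) (tabulate id)   ≡⟨ map-tabulate id (f ∘ List.lookup xs) ⟩
  tabulate (f ∘ List.lookup xs)            ≡⟨ map-tabulate (List.lookup xs) f ⟨
  map f (tabulate (List.lookup xs))        ≡⟨ cong (map f) (tabulate-lookup xs) ⟩
  map f xs                                 ∎)
  where open ≡-Reasoning

length-rows : (bs : List (Block n)) → length (rows bs) ≡ sum (map proj₁ bs)
length-rows [] = refl
length-rows ((r , w) ∷ bs) =
  trans (length-++ (replicate r w)) (cong₂ _+_ (length-replicate r) (length-rows bs))

All-rows : ∀ {P : Row n → Set} {bs : List (Block n)} → All (P ∘ proj₂) bs → All P (rows bs)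
All-rows [] = []
All-rows {bs = (r , w) ∷ _} (pw ∷ pbs) = ++⁺ (replicate⁺ r pw) (All-rows pbs)

coordSum-copies : ∀ k r (c : Maybe (Grp n)) → coordSum k (copies r c) ≡ r * coordSum k (fromMaybe c)
coordSum-copies k r (just g) = trans (coordSum-replicate k r g) (cong (r *_) (sym (+-identityʳ _)))
coordSum-copies k r nothing  = sym (*-zeroʳ r)

coordSum-column : ∀ k j (bs : List (Block n)) →
  coordSum k (column j bs) ≡ sum (map (λ (r , w) → r * coordSum k (cells w j)) bs)
coordSum-column k j [] = refl
coordSum-column k j ((r , w) ∷ bs) =
  trans (coordSum-++ k (copies r (Vec.lookup w j)) _)
        (cong₂ _+_ (coordSum-copies k r (Vec.lookup w j)) (coordSum-column k j bs))

length-column : ∀ j (bs : List (Block n)) →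
  length (column j bs) ≡ sum (map (λ (r , w) → r * length (cells w j)) bs)
length-column j [] = refl
length-column j ((r , w) ∷ bs) with Vec.lookup w j
... | just x  = trans (length-++ (replicate r x))
                      (cong₂ _+_ (trans (length-replicate r) (sym (*-identityʳ r))) (length-column j bs))
... | nothing = cong₂ _+_ (sym (*-zeroʳ r)) (length-column j bs)

All-column : ∀ {P : Grp n → Set} j {bs : List (Block n)} →
  All (λ (r , w) → All P (cells w j)) bs → All P (column j bs)
All-column j [] = []
All-column j {(r , w) ∷ _} (pw ∷ pbs) = ++⁺ (copies⁺ r (Vec.lookup w j) pw) (All-column j pbs)
  where
  copies⁺ : ∀ {P : Grp _ → Set} r c → All P (fromMaybe c) → All P (copies r c)
  copies⁺ r (just x) (px ∷ []) = replicate⁺ r px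
  copies⁺ r nothing  []        = []

blockFactorization : (bs : List (Block n)) → All (IsAtom n ∘ rowProduct ∘ proj₂) bs →
                     ((j : Fin 3) → IsAtom n (column j bs)) → Factorization3 n
blockFactorization bs W-atoms U-atoms = record
  { ρ      = length (rows bs)
  ; U      = λ j → column j bs
  ; T      = cells ∘ List.lookup (rows bs)
  ; U-atom = U-atoms
  ; W-atom = λ i → All.lookup (All-rows W-atoms) (∈-lookup i)
  ; cols   = λ j → ↭-reflexive (trans (prodSeq-lookup (λ w → cells w j) (rows bs))
                                      (concatMap-cells-rows j bs))
  }

row₁₂ row₁₃ row₂₃ : Grp n → Grp n → Row n
row₁₂ a b = just a ∷ just b ∷ nothing ∷ []
row₁₃ a b = just a ∷ nothing ∷ just b ∷ []
row₂₃ a b = nothing ∷ just a ∷ just b ∷ []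

data Sign : Set where
  0ₛ 1ₛ -1ₛ : Sign

Signs : Set
Signs = Sign × Sign × Sign

negₛ : Sign → Sign
negₛ 0ₛ  = 0ₛ
negₛ 1ₛ  = -1ₛ
negₛ -1ₛ = 1ₛ

-_ : Signs → Signs
- (a , b , c) = negₛ a , negₛ b , negₛ c

-‿involutive : ∀ s → - (- s) ≡ s
-‿involutive (a , b , c) = cong₂ _,_ (negₛ-involutive a) (cong₂ _,_ (negₛ-involutive b) (negₛ-involutive c))
  where
  negₛ-involutive : ∀ a → negₛ (negₛ a) ≡ a
  negₛ-involutive 0ₛ  = refl
  negₛ-involutive 1ₛ  = refl
  negₛ-involutive -1ₛ = refl

-- The residue n - 1 is a parameter, instantiated with fromℕ, so that toℕ of it stays
-- opaque and is rewritten only where the arithmetic needs it.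
module Signed (m : ℕ) (-1ᶠ : Fin (2 + m)) (toℕ-1ᶠ : toℕ -1ᶠ ≡ suc m) where

  ⟦_⟧ : Sign → Fin (2 + m)
  ⟦ 0ₛ ⟧  = zero
  ⟦ 1ₛ ⟧  = suc zero
  ⟦ -1ₛ ⟧ = -1ᶠ

  ⟨_⟩ : Signs → Grp (2 + m)
  ⟨ a , b , c ⟩ = ⟦ a ⟧ ∷ ⟦ b ⟧ ∷ ⟦ c ⟧ ∷ []

  coprime-1 : Coprime (2 + m) 1
  coprime-1 = Coprimality.sym (1-coprimeTo (2 + m))

  coprime-[-1] : Coprime (2 + m) (toℕ -1ᶠ)
  coprime-[-1] rewrite toℕ-1ᶠ =
    subst (λ x → Coprime x (suc m)) (+-comm (suc m) 1) (coprime-+ (1-coprimeTo (suc m)))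

  ∣⟦⟧⇒0ₛ : ∀ s → 2 + m ∣ toℕ ⟦ s ⟧ + 0 → s ≡ 0ₛ
  ∣⟦⟧⇒0ₛ 0ₛ _ = refl
  ∣⟦⟧⇒0ₛ 1ₛ N∣1 with () ← <∧∣⇒≡0 (s≤s (s≤s z≤n)) N∣1
  ∣⟦⟧⇒0ₛ -1ₛ N∣-1 rewrite toℕ-1ᶠ with () ← <∧∣⇒≡0 ≤-refl (subst (2 + m ∣_) (+-identityʳ _) N∣-1)

  ∣⟦⟧+⟦neg⟧ : ∀ s → 2 + m ∣ toℕ ⟦ s ⟧ + (toℕ ⟦ negₛ s ⟧ + 0)
  ∣⟦⟧+⟦neg⟧ 0ₛ  = _ ∣0
  ∣⟦⟧+⟦neg⟧ 1ₛ  rewrite toℕ-1ᶠ = divides 1 refl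
  ∣⟦⟧+⟦neg⟧ -1ₛ rewrite toℕ-1ᶠ = divides 1 (trans (+-comm (suc m) 1) (sym (*-identityˡ (2 + m))))

  ¬zeroSum-[⟨⟩] : ∀ s → s ≢ (0ₛ , 0ₛ , 0ₛ) → ¬ ZeroSum (2 + m) (⟨ s ⟩ ∷ [])
  ¬zeroSum-[⟨⟩] (a , b , c) s≢0 z
    with refl ← ∣⟦⟧⇒0ₛ a (z zero) | refl ← ∣⟦⟧⇒0ₛ b (z (suc zero)) | refl ← ∣⟦⟧⇒0ₛ c (z (suc (suc zero)))
    = s≢0 refl

  pair-atomₛ : ∀ s → s ≢ (0ₛ , 0ₛ , 0ₛ) → IsAtom (2 + m) (⟨ s ⟩ ∷ ⟨ - s ⟩ ∷ [])
  pair-atomₛ s@(a , b , c) s≢0 =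
    pair-atom ⟨ s ⟩ ⟨ - s ⟩ zs (¬zeroSum-[⟨⟩] s s≢0) (¬zeroSum-[⟨⟩] (- s) (s≢0 ∘ neg≡0))
    where
    zs : ZeroSum (2 + m) (⟨ s ⟩ ∷ ⟨ - s ⟩ ∷ [])
    zs zero             = ∣⟦⟧+⟦neg⟧ a
    zs (suc zero)       = ∣⟦⟧+⟦neg⟧ b
    zs (suc (suc zero)) = ∣⟦⟧+⟦neg⟧ c
    neg≡0 : - s ≡ (0ₛ , 0ₛ , 0ₛ) → s ≡ (0ₛ , 0ₛ , 0ₛ)
    neg≡0 -s≡0 = trans (sym (-‿involutive s)) (cong -_ -s≡0)

  pairs : ℕ → (Grp (2 + m) → Grp (2 + m) → Row (2 + m)) → Signs → Block (2 + m)
  pairs r row s = r , row ⟨ s ⟩ ⟨ - s ⟩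

ρ₃-bound : ℕ → Set
ρ₃-bound n = Σ (Factorization3 n) λ F → let open Factorization3 F in
  (Dstar3 n + Dstar3 n / 2 ≤ ρ) ×
  ((i : Fin ρ) → (spread i ≡ 2) ⊎ (spread i ≡ 3)) ×
  (Dstar3 n % 2 ≡ 1 → length (filter (λ i → spread i ≟ 3) (allFin ρ)) ≡ 1) ×
  (Dstar3 n % 2 ≡ 0 → (i : Fin ρ) → spread i ≡ 2)

Dstar3-2+ : ∀ x → Dstar3 (2 + x) ≡ 4 + 3 * x
Dstar3-2+ = unfolded
  where
  unfolded : ∀ x → x + (2 + x + (2 + x + 0)) ≡ 4 + 3 * x
  unfolded = solve-∀

[r+h*2]/2≡h : ∀ r h → r < 2 → (r + h * 2) / 2 ≡ h
[r+h*2]/2≡h r h r<2 = begin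
  (r + h * 2) / 2     ≡⟨ +-distrib-/-∣ʳ r (divides h refl) ⟩
  r / 2 + h * 2 / 2   ≡⟨ cong₂ _+_ (m<n⇒m/n≡0 r<2) (m*n/n≡m h 2) ⟩
  h                   ∎
  where open ≡-Reasoning

half-bound : ∀ {D ρ} r h → r < 2 → D ≡ r + h * 2 → ρ ≡ (r + h * 2) + h → D + D / 2 ≤ ρ
half-bound r h r<2 refl refl = ≤-reflexive (cong ((r + h * 2) +_) ([r+h*2]/2≡h r h r<2))

[r+h*2]%2≡r : ∀ r h → r < 2 → (r + h * 2) % 2 ≡ r
[r+h*2]%2≡r r h r<2 = trans ([m+kn]%n≡m%n r h 2) (m<n⇒m%n≡m r<2)

module EvenConstruction (j : ℕ) (-1ᶠ : Fin (2 + (j + j))) (toℕ-1ᶠ : toℕ -1ᶠ ≡ suc (j + j)) where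
  open Signed (j + j) -1ᶠ toℕ-1ᶠ

  -- U₁ = e₁^{n-1} e₂^{n-1} p^j a p^j b,  U₂ = (-e₁)^{n-1} e₃^{n-1} (-p)^j (-a) u^j u′,
  -- U₃ = (-e₂)^{n-1} (-e₃)^{n-1} (-p)^j (-b) (-u)^j (-u′), with n = 2j + 2.

  e₁ e₂ e₃ p a b u u′ : Signs
  e₁ = 1ₛ  , 0ₛ  , 0ₛ
  e₂ = 0ₛ  , 1ₛ  , 0ₛ
  e₃ = 0ₛ  , 0ₛ  , 1ₛ
  p  = -1ₛ , -1ₛ , 1ₛ
  a  = 0ₛ  , -1ₛ , 1ₛ
  b  = -1ₛ , 0ₛ  , 1ₛ
  u  = -1ₛ , 1ₛ  , -1ₛ
  u′ = -1ₛ , 1ₛ  , 0ₛ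

  rest blocks : List (Block (2 + (j + j)))
  rest = pairs j row₁₂ p ∷ pairs 1 row₁₂ a ∷ pairs j row₁₃ p ∷ pairs 1 row₁₃ b ∷
         pairs j row₂₃ u ∷ pairs 1 row₂₃ u′ ∷ []
  blocks = pairs (suc (j + j)) row₁₂ e₁ ∷ pairs (suc (j + j)) row₁₃ e₂ ∷
           pairs (suc (j + j)) row₂₃ e₃ ∷ rest

  W-atoms : All (IsAtom (2 + (j + j)) ∘ rowProduct ∘ proj₂) blocks
  W-atoms = pair-atomₛ e₁ (λ ()) ∷ pair-atomₛ e₂ (λ ()) ∷ pair-atomₛ e₃ (λ ()) ∷
            pair-atomₛ p (λ ()) ∷ pair-atomₛ a (λ ()) ∷ pair-atomₛ p (λ ()) ∷
            pair-atomₛ b (λ ()) ∷ pair-atomₛ u (λ ()) ∷ pair-atomₛ u′ (λ ()) ∷ []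

  column-zeroSum : ∀ i → ZeroSum (2 + (j + j)) (column i blocks)
  column-zeroSum i k rewrite coordSum-column k i blocks with i | k
  ... | zero           | zero           rewrite toℕ-1ᶠ = divides (suc (j + j)) (solve (j List.∷ List.[]))
  ... | zero           | suc zero       rewrite toℕ-1ᶠ = divides (suc (j + j)) (solve (j List.∷ List.[]))
  ... | zero           | suc (suc zero)                = divides 1 (solve (j List.∷ List.[]))
  ... | suc zero       | zero           rewrite toℕ-1ᶠ = divides (suc (j + j) + j) (solve (j List.∷ List.[]))
  ... | suc zero       | suc zero                      = divides 1 (solve (j List.∷ List.[]))
  ... | suc zero       | suc (suc zero) rewrite toℕ-1ᶠ = divides (suc (j + j)) (solve (j List.∷ List.[]))
  ... | suc (suc zero) | zero                          = divides 1 (solve (j List.∷ List.[]))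
  ... | suc (suc zero) | suc zero       rewrite toℕ-1ᶠ = divides (suc (j + j) + j) (solve (j List.∷ List.[]))
  ... | suc (suc zero) | suc (suc zero) rewrite toℕ-1ᶠ = divides (suc (j + j) + j) (solve (j List.∷ List.[]))

  rest-length : ∀ i → length (column i rest) ≡ 2 + (j + j)
  rest-length i rewrite length-column i rest with i
  ... | zero           = solve (j List.∷ List.[])
  ... | suc zero       = solve (j List.∷ List.[])
  ... | suc (suc zero) = solve (j List.∷ List.[])

  U-atoms : ∀ i → IsAtom (2 + (j + j)) (column i blocks)
  U-atoms zero =
    sandwich-atom zero (suc zero) ⟨ e₁ ⟩ ⟨ e₂ ⟩ coprime-1 coprime-1 refl
      (suc (suc zero)) [] (suc (j + j)) (suc (j + j)) (column zero rest) refl refl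
      [] (All-column zero {rest} ((refl ∷ []) ∷ (refl ∷ []) ∷ (refl ∷ []) ∷ (refl ∷ []) ∷ [] ∷ [] ∷ []))
      (rest-length zero) ≤-refl ≤-refl (column-zeroSum zero)
  U-atoms (suc zero) =
    sandwich-atom zero (suc (suc zero)) ⟨ - e₁ ⟩ ⟨ e₃ ⟩ coprime-[-1] coprime-1 refl
      (suc zero) [] (suc (j + j)) (suc (j + j)) (column (suc zero) rest) refl refl
      [] (All-column (suc zero) {rest} ((refl ∷ []) ∷ (refl ∷ []) ∷ [] ∷ [] ∷ (refl ∷ []) ∷ (refl ∷ []) ∷ []))
      (rest-length (suc zero)) ≤-refl ≤-refl (column-zeroSum (suc zero))
  U-atoms (suc (suc zero)) =
    sandwich-atom (suc zero) (suc (suc zero)) ⟨ - e₂ ⟩ ⟨ - e₃ ⟩ coprime-[-1] coprime-[-1] refl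
      zero [] (suc (j + j)) (suc (j + j)) (column (suc (suc zero)) rest) refl refl
      [] (All-column (suc (suc zero)) {rest} ([] ∷ [] ∷ (refl ∷ []) ∷ (refl ∷ []) ∷ (refl ∷ []) ∷ (refl ∷ []) ∷ []))
      (rest-length (suc (suc zero))) ≤-refl ≤-refl
      (column-zeroSum (suc (suc zero)))

  spreads : All ((_≡ 2) ∘ rowSpread ∘ proj₂) blocks
  spreads = refl ∷ refl ∷ refl ∷ refl ∷ refl ∷ refl ∷ refl ∷ refl ∷ refl ∷ []

  Dstar3≡ : Dstar3 (2 + (j + j)) ≡ 0 + (2 + 3 * j) * 2
  Dstar3≡ = trans (Dstar3-2+ (j + j)) (solve (j List.∷ List.[]))

  length-rows-blocks : length (rows blocks) ≡ (0 + (2 + 3 * j) * 2) + (2 + 3 * j)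
  length-rows-blocks rewrite length-rows blocks = solve (j List.∷ List.[])

  result : ρ₃-bound (2 + (j + j))
  result = blockFactorization blocks W-atoms U-atoms
         , half-bound 0 (2 + 3 * j) (s≤s z≤n) Dstar3≡ length-rows-blocks
         , inj₁ ∘ spread≡2
         , (λ D%2≡1 → ⊥-elim (0≢1+n (trans (sym D%2≡0) D%2≡1)))
         , (λ _ → spread≡2)
    where
    spread≡2 : ∀ i → rowSpread (List.lookup (rows blocks) i) ≡ 2
    spread≡2 i = All.lookup (All-rows spreads) (∈-lookup i)
    D%2≡0 : Dstar3 (2 + (j + j)) % 2 ≡ 0
    D%2≡0 = trans (cong (_% 2) Dstar3≡) ([r+h*2]%2≡r 0 (2 + 3 * j) (s≤s z≤n))

module OddConstruction (j : ℕ) (-1ᶠ : Fin (3 + (j + j))) (toℕ-1ᶠ : toℕ -1ᶠ ≡ suc (suc (j + j))) where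
  open Signed (suc (j + j)) -1ᶠ toℕ-1ᶠ

  -- U₁ = g₁ e₁^{n-1} e₂^{n-1} p^{2j+2},  U₂ = g₂ (-e₁)^{n-1} e₃^{n-1} (-p)^{j+1} u^{j+1},
  -- U₃ = g₃ (-e₂)^{n-1} (-e₃)^{n-1} (-p)^{j+1} (-u)^{j+1}, with n = 2j + 3.

  e₁ e₂ e₃ p u g₁ g₂ g₃ : Signs
  e₁ = 1ₛ  , 0ₛ  , 0ₛ
  e₂ = 0ₛ  , 1ₛ  , 0ₛ
  e₃ = 0ₛ  , 0ₛ  , 1ₛ
  p  = -1ₛ , -1ₛ , 1ₛ
  u  = -1ₛ , 1ₛ  , -1ₛ
  g₁ = 0ₛ  , 0ₛ  , 1ₛ
  g₂ = -1ₛ , 1ₛ  , 0ₛ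
  g₃ = 1ₛ  , -1ₛ , -1ₛ

  triple : Row (3 + (j + j))
  triple = just ⟨ g₁ ⟩ ∷ just ⟨ g₂ ⟩ ∷ just ⟨ g₃ ⟩ ∷ []

  rest pairBlocks blocks : List (Block (3 + (j + j)))
  rest = pairs (suc j) row₁₂ p ∷ pairs (suc j) row₁₃ p ∷ pairs (suc j) row₂₃ u ∷ []
  pairBlocks = pairs (2 + (j + j)) row₁₂ e₁ ∷ pairs (2 + (j + j)) row₁₃ e₂ ∷
               pairs (2 + (j + j)) row₂₃ e₃ ∷ rest
  blocks = (1 , triple) ∷ pairBlocks

  triple-atom′ : IsAtom (3 + (j + j)) (rowProduct triple)
  triple-atom′ = triple-atom ⟨ g₁ ⟩ ⟨ g₂ ⟩ ⟨ g₃ ⟩ zs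
    (¬zeroSum-[⟨⟩] g₁ (λ ())) (¬zeroSum-[⟨⟩] g₂ (λ ())) (¬zeroSum-[⟨⟩] g₃ (λ ()))
    (λ z → contradiction (∣⟦⟧⇒0ₛ 1ₛ (z (suc (suc zero)))) λ ())
    (λ z → contradiction (∣⟦⟧⇒0ₛ 1ₛ (z zero)) λ ())
    (λ z → contradiction (∣⟦⟧⇒0ₛ -1ₛ (z (suc (suc zero)))) λ ())
    where
    zs : ZeroSum (3 + (j + j)) (⟨ g₁ ⟩ ∷ ⟨ g₂ ⟩ ∷ ⟨ g₃ ⟩ ∷ [])
    zs zero             rewrite toℕ-1ᶠ = divides 1 (solve (j List.∷ List.[]))
    zs (suc zero)       rewrite toℕ-1ᶠ = divides 1 (solve (j List.∷ List.[]))
    zs (suc (suc zero)) rewrite toℕ-1ᶠ = divides 1 (solve (j List.∷ List.[]))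

  W-atoms : All (IsAtom (3 + (j + j)) ∘ rowProduct ∘ proj₂) blocks
  W-atoms = triple-atom′ ∷ pair-atomₛ e₁ (λ ()) ∷ pair-atomₛ e₂ (λ ()) ∷ pair-atomₛ e₃ (λ ()) ∷
            pair-atomₛ p (λ ()) ∷ pair-atomₛ p (λ ()) ∷ pair-atomₛ u (λ ()) ∷ []

  column-zeroSum : ∀ i → ZeroSum (3 + (j + j)) (column i blocks)
  column-zeroSum i k rewrite coordSum-column k i blocks with i | k
  ... | zero           | zero           rewrite toℕ-1ᶠ = divides (2 + (j + j)) (solve (j List.∷ List.[]))
  ... | zero           | suc zero       rewrite toℕ-1ᶠ = divides (2 + (j + j)) (solve (j List.∷ List.[]))
  ... | zero           | suc (suc zero)                = divides 1 (solve (j List.∷ List.[]))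
  ... | suc zero       | zero           rewrite toℕ-1ᶠ = divides (3 + (j + j) + j) (solve (j List.∷ List.[]))
  ... | suc zero       | suc zero                      = divides 1 (solve (j List.∷ List.[]))
  ... | suc zero       | suc (suc zero) rewrite toℕ-1ᶠ = divides (2 + (j + j)) (solve (j List.∷ List.[]))
  ... | suc (suc zero) | zero                          = divides 1 (solve (j List.∷ List.[]))
  ... | suc (suc zero) | suc zero       rewrite toℕ-1ᶠ = divides (3 + (j + j) + j) (solve (j List.∷ List.[]))
  ... | suc (suc zero) | suc (suc zero) rewrite toℕ-1ᶠ = divides (3 + (j + j) + j) (solve (j List.∷ List.[]))

  rest-length : ∀ i → length (column i rest) ≡ 2 + (j + j)
  rest-length i rewrite length-column i rest with i
  ... | zero           = solve (j List.∷ List.[])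
  ... | suc zero       = solve (j List.∷ List.[])
  ... | suc (suc zero) = solve (j List.∷ List.[])

  U-atoms : ∀ i → IsAtom (3 + (j + j)) (column i blocks)
  U-atoms zero =
    sandwich-atom zero (suc zero) ⟨ e₁ ⟩ ⟨ e₂ ⟩ coprime-1 coprime-1 refl
      (suc (suc zero)) (⟨ g₁ ⟩ ∷ []) (2 + (j + j)) (2 + (j + j)) (column zero rest) refl refl
      (refl ∷ []) (All-column zero {rest} ((refl ∷ []) ∷ (refl ∷ []) ∷ [] ∷ []))
      (cong suc (rest-length zero)) ≤-refl ≤-refl (column-zeroSum zero)
  U-atoms (suc zero) =
    sandwich-atom zero (suc (suc zero)) ⟨ - e₁ ⟩ ⟨ e₃ ⟩ coprime-[-1] coprime-1 refl
      (suc zero) (⟨ g₂ ⟩ ∷ []) (2 + (j + j)) (2 + (j + j)) (column (suc zero) rest) refl refl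
      (refl ∷ []) (All-column (suc zero) {rest} ((refl ∷ []) ∷ [] ∷ (refl ∷ []) ∷ []))
      (cong suc (rest-length (suc zero))) ≤-refl ≤-refl (column-zeroSum (suc zero))
  U-atoms (suc (suc zero)) =
    sandwich-atom (suc zero) (suc (suc zero)) ⟨ - e₂ ⟩ ⟨ - e₃ ⟩ coprime-[-1] coprime-[-1] refl
      zero (⟨ g₃ ⟩ ∷ []) (2 + (j + j)) (2 + (j + j)) (column (suc (suc zero)) rest) refl refl
      (refl ∷ []) (All-column (suc (suc zero)) {rest} ([] ∷ (refl ∷ []) ∷ (refl ∷ []) ∷ []))
      (cong suc (rest-length (suc (suc zero)))) ≤-refl ≤-refl (column-zeroSum (suc (suc zero)))

  spreads : All ((_≡ 2) ∘ rowSpread ∘ proj₂) pairBlocks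
  spreads = refl ∷ refl ∷ refl ∷ refl ∷ refl ∷ refl ∷ []

  Dstar3≡ : Dstar3 (3 + (j + j)) ≡ 1 + (3 + 3 * j) * 2
  Dstar3≡ = trans (Dstar3-2+ (suc (j + j))) (solve (j List.∷ List.[]))

  length-rows-blocks : length (rows blocks) ≡ (1 + (3 + 3 * j) * 2) + (3 + 3 * j)
  length-rows-blocks rewrite length-rows blocks = solve (j List.∷ List.[])

  result : ρ₃-bound (3 + (j + j))
  result = blockFactorization blocks W-atoms U-atoms
         , half-bound 1 (3 + 3 * j) (s≤s (s≤s z≤n)) Dstar3≡ length-rows-blocks
         , (λ { zero → inj₂ refl ; (suc i) → inj₁ (spread≡2 i) })
         , (λ _ → cong (suc ∘ length) (filter-none (λ i → rowSpread (List.lookup (rows blocks) i) ≟ 3)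
                    (tabulate⁺ {f = suc} λ i → 2≢3 ∘ trans (sym (spread≡2 i)))))
         , (λ D%2≡0 → ⊥-elim (0≢1+n (trans (sym D%2≡0) D%2≡1)))
    where
    spread≡2 : ∀ i → rowSpread (List.lookup (rows pairBlocks) i) ≡ 2
    spread≡2 i = All.lookup (All-rows spreads) (∈-lookup i)
    2≢3 : 2 ≢ 3
    2≢3 ()
    D%2≡1 : Dstar3 (3 + (j + j)) % 2 ≡ 1
    D%2≡1 = trans (cong (_% 2) Dstar3≡) ([r+h*2]%2≡r 1 (3 + 3 * j) (s≤s (s≤s z≤n)))

even⊎odd : ∀ n → 2 ≤ n → (∃[ j ] n ≡ 2 + (j + j)) ⊎ (∃[ j ] n ≡ 3 + (j + j))
even⊎odd (suc zero) (s≤s ())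
even⊎odd (suc (suc zero)) _ = inj₁ (0 , refl)
even⊎odd (suc (suc (suc zero))) _ = inj₂ (0 , refl)
even⊎odd (suc (suc (suc (suc n)))) _ with even⊎odd (suc (suc n)) (s≤s (s≤s z≤n))
... | inj₁ (j , refl) = inj₁ (suc j , cong (λ x → 3 + x) (sym (+-suc j j)))
... | inj₂ (j , refl) = inj₂ (suc j , cong (λ x → 4 + x) (sym (+-suc j j)))

lemma4p6 : (n : ℕ) → 2 ≤ n →
    Σ (Factorization3 n) λ F → let open Factorization3 F in
    (Dstar3 n + Dstar3 n / 2 ≤ ρ) ×
    ((i : Fin ρ) → (spread i ≡ 2) ⊎ (spread i ≡ 3)) ×
    (Dstar3 n % 2 ≡ 1 → length (filter (λ i → spread i ≟ 3) (allFin ρ)) ≡ 1) ×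
    (Dstar3 n % 2 ≡ 0 → (i : Fin ρ) → spread i ≡ 2)
lemma4p6 n 2≤n with even⊎odd n 2≤n
... | inj₁ (j , refl) = EvenConstruction.result j (fromℕ _) (toℕ-fromℕ _)
... | inj₂ (j , refl) = OddConstruction.result j (fromℕ _) (toℕ-fromℕ _)
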